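{- Let $p$ be an odd prime, $g$ a primitive root modulo $p$, $d$ a positive divisor of $p-1$, $k=(p-1)/d$, $\Gamma=\langle g^d\rangle$, and $X_m=g^m\Gamma$. For $0\le m\le d-1$ let $c_{0,m,m}$ be the number of $(a,b)\in\Gamma\times\Gamma$ with $a+g^mb=g^m$. Suppose $(p,k)$ is circular, $2\mid k$, and $0\le m\le d-1$. Then $c_{0,m,m}=1$ if and only if $2^{ -1}\in X_m$ (where $2^{ -1}$ is the inverse of $2$ in $\mathbb{F}_p$).
   Context: The pair $(p,k)$ is called circular if $k\mid(p-1)$ and, with $\Phi$ the subgroup of $\mathbb{F}_p^\times$ of order $k$, one has $|(\Phi a+b)\cap(\Phi c+e)|\le2$ for all $a,c\in\mathbb{F}_p^\times$ and $b,e\in\mathbb{F}_p$ with $\Phi a\neq\Phi c$ or $b\neq e$. -}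

module Defs where

open import Data.Nat using (ℕ; zero; suc; _+_; _*_; _∸_; _^_; _≤_; _<_; _≡ᵇ_)
open import Data.Nat.Properties using (_≟_)
open import Data.Nat.DivMod using (_%_)
open import Data.Nat.Divisibility using (_∣_)
open import Data.Bool using (Bool; _∧_; _∨_; not)
open import Data.List using (List; map; upTo; length; filterᵇ; cartesianProduct)
open import Data.List.Membership.Propositional using (_∈_)
open import Data.List.Membership.DecPropositional _≟_ using (_∈?_)
open import Data.List.Relation.Unary.Unique.Propositional using (Unique)
open import Data.Product using (_×_; _,_; ∃-syntax; proj₁; proj₂)
open import Data.Sum using (_⊎_)
open import Relation.Nullary using (¬_; ⌊_⌋)
open import Relation.Binary.PropositionalEquality using (_≡_; _≢_)
open import Function.Bundles using (_⇔_)

-- Elements of 𝔽_p are represented by natural numbers x < p (residues mod p);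
-- arithmetic in 𝔽_p is ℕ-arithmetic followed by "% p".

PrimitiveRoot : (p g : ℕ) → .{{_ : Data.Nat.NonZero p}} → Set
PrimitiveRoot p g =
  (g ^ (p ∸ 1)) % p ≡ 1 × (∀ i → 0 < i → i < p ∸ 1 → (g ^ i) % p ≢ 1)

Γlist : (p g d k : ℕ) → .{{_ : Data.Nat.NonZero p}} → List ℕ
Γlist p g d k = map (λ j → ((g ^ d) ^ j) % p) (upTo k)

Xlist : (p g d k m : ℕ) → .{{_ : Data.Nat.NonZero p}} → List ℕ
Xlist p g d k m = map (λ γ → (g ^ m * γ) % p) (Γlist p g d k)

c0mm : (p g d k m : ℕ) → .{{_ : Data.Nat.NonZero p}} → ℕ
c0mm p g d k m =
  length (filterᵇ
    (λ ab → ⌊ proj₁ ab ∈? Γ ⌋ ∧ ⌊ proj₂ ab ∈? Γ ⌋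
            ∧ (((proj₁ ab + g ^ m * proj₂ ab) % p) ≡ᵇ ((g ^ m) % p)))
    (cartesianProduct (upTo p) (upTo p)))
  where Γ = Γlist p g d k

IsSubgroupOfOrder : (p k : ℕ) → .{{_ : Data.Nat.NonZero p}} → List ℕ → Set
IsSubgroupOfOrder p k Φ =
  Unique Φ × length Φ ≡ k
  × (∀ x → x ∈ Φ → 0 < x × x < p)
  × 1 ∈ Φ
  × (∀ x y → x ∈ Φ → y ∈ Φ → (x * y) % p ∈ Φ)
  × (∀ x → x ∈ Φ → ∃[ y ] (y ∈ Φ × (x * y) % p ≡ 1))

cosetShift : (p : ℕ) → .{{_ : Data.Nat.NonZero p}} → List ℕ → ℕ → ℕ → List ℕ
cosetShift p Φ a b = map (λ φ → (φ * a + b) % p) Φ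

interCount : (p : ℕ) → .{{_ : Data.Nat.NonZero p}} → List ℕ → ℕ → ℕ → ℕ → ℕ → ℕ
interCount p Φ a b c e =
  length (filterᵇ (λ x → ⌊ x ∈? cosetShift p Φ a b ⌋ ∧ ⌊ x ∈? cosetShift p Φ c e ⌋)
                  (upTo p))

-- (p,k) is circular: k ∣ p-1 and, Φ being the subgroup of 𝔽_p^× of order k,
-- |(Φa+b) ∩ (Φc+e)| ≤ 2 whenever Φa ≠ Φc (as sets) or b ≠ e,
-- for a, c ∈ 𝔽_p^× and b, e ∈ 𝔽_p.
-- ("the" subgroup is rendered as "every subgroup of order k"; it is unique.)
Circular : (p k : ℕ) → .{{_ : Data.Nat.NonZero p}} → Set
Circular p k =
  k ∣ (p ∸ 1)
  × (∀ Φ → IsSubgroupOfOrder p k Φ →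
      ∀ a b c e → 0 < a → a < p → b < p → 0 < c → c < p → e < p →
      (¬ (∀ x → (x ∈ cosetShift p Φ a 0) ⇔ (x ∈ cosetShift p Φ c 0)) ⊎ b ≢ e) →
      interCount p Φ a b c e ≤ 2)

-- Write G = g^m. The pairs (a, b) ∈ Γ × Γ with a + G b = G are determined by either
-- coordinate, never have b = 1, and, since −1 ∈ Γ for even k, come in pairs
-- (a, b) ↦ (−a b⁻¹, b⁻¹). Every a-coordinate lies in Γ ∩ (−GΓ + G), which circularity
-- bounds by 2, so no three solutions have pairwise distinct b. Hence there is exactly one
-- solution iff some solution has b = b⁻¹ ≠ 1, i.e. b = −1; that solution is a = 2G, and
-- 2G ∈ Γ iff 2⁻¹ ∈ GΓ = X_m.
module Submission where

open import Defs
open import Data.Nat using (ℕ; _*_; _∸_; _<_; _%_; NonZero)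
open import Data.Nat.Divisibility using (_∣_)
open import Data.Nat.Primality using (Prime)
open import Data.List.Membership.Propositional using (_∈_)
open import Data.Product using (_×_)
open import Relation.Binary.PropositionalEquality using (_≡_; _≢_)
open import Function.Bundles using (_⇔_)

open import Level using (0ℓ)
open import Data.Bool using (Bool; T; _∧_)
open import Data.Bool.Properties using (T-∧)
open import Data.Empty using (⊥)
open import Data.Sum using (_⊎_; inj₁; inj₂; [_,_]′)
open import Data.Product using (_,_; ∃-syntax; proj₁; proj₂)
open import Data.Nat
  using (zero; suc; _+_; _^_; _/_; _≡ᵇ_; _≤_; z≤n; s≤s;
         >-nonZero; >-nonZero⁻¹; ≢-nonZero; ≢-nonZero⁻¹; nonTrivial⇒n>1)
open import Data.Nat.Properties
open import Data.Nat.DivMod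
  using (m%n%n≡m%n; %-distribˡ-+; %-distribˡ-*; m*n%n≡0; m<n⇒m%n≡m; m%n<n; m≡m%n+[m/n]*n)
open import Data.Nat.Divisibility using (divides; m%n≡0⇒n∣m; ∣⇒≤; >⇒∤)
open import Data.Nat.Primality using (euclidsLemma; prime⇒nonTrivial)
open import Data.Nat.Tactic.RingSolver using (solve-∀)
open import Data.List using (List; []; _∷_; [_]; map; upTo; length; filterᵇ; cartesianProduct)
open import Data.List.Properties using (length-map; length-applyUpTo; length-removeAt′)
open import Data.List.Membership.Propositional using (_─_)
open import Data.List.Membership.Propositional.Properties
  using (∈-map⁺; ∈-map⁻; ∈-upTo⁺; ∈-filter⁺; ∈-filter⁻; ∈-cartesianProduct⁺)
open import Data.List.Membership.DecPropositional _≟_ using (_∈?_)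
open import Data.List.Relation.Binary.Subset.Propositional using (_⊆_)
open import Data.List.Relation.Unary.Any using (here; there; index)
open import Data.List.Relation.Unary.All using ([]; _∷_) renaming (lookup to All-lookup)
open import Data.List.Relation.Unary.AllPairs using ([]; _∷_)
import Data.List.Relation.Unary.AllPairs.Properties as AllPairs
open import Data.List.Relation.Unary.Unique.Propositional using (Unique)
import Data.List.Relation.Unary.Unique.Propositional.Properties as Unique
open import Function.Base using (id; _∘_)
open import Function.Bundles using (mk⇔; module Equivalence)
open import Function.Properties.Equivalence using () renaming (trans to ⇔-trans)
open import Relation.Binary.Bundles using (Setoid)
import Relation.Binary.Construct.On as On
import Relation.Binary.Reasoning.Setoid
open import Relation.Binary.PropositionalEquality
  using (refl; sym; trans; cong; cong₂; subst; setoid; module ≡-Reasoning)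
open import Relation.Nullary using (¬_; contradiction; ⌊_⌋)
open import Relation.Nullary.Decidable using (toWitness; fromWitness; T?; decidable-stable)

prime⇒1<p : ∀ {p} → Prime p → 1 < p
prime⇒1<p {p} p-prime = nonTrivial⇒n>1 p {{prime⇒nonTrivial p-prime}}

i+i*[n∸1]≡n*i : ∀ i n .{{_ : NonZero n}} → i + i * (n ∸ 1) ≡ n * i
i+i*[n∸1]≡n*i i n = begin
  i + i * (n ∸ 1)     ≡⟨ *-suc i (n ∸ 1) ⟨
  i * suc (n ∸ 1)     ≡⟨ cong (i *_) (m+[n∸m]≡n (>-nonZero⁻¹ n)) ⟩
  i * n               ≡⟨ *-comm i n ⟩
  n * i               ∎
  where open ≡-Reasoning

[x+x]*y≡2*[x*y] : ∀ x y → (x + x) * y ≡ 2 * (x * y)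
[x+x]*y≡2*[x*y] = solve-∀

x*[2+x]+1≡[1+x]*[1+x] : ∀ x → x * (2 + x) + 1 ≡ suc x * suc x
x*[2+x]+1≡[1+x]*[1+x] = solve-∀

module _ {A : Set} where

  ∈-─ : ∀ {x z : A} {ys} (x∈ys : x ∈ ys) → z ∈ ys → z ≢ x → z ∈ ys ─ x∈ys
  ∈-─ (here refl) (here refl)  z≢x = contradiction refl z≢x
  ∈-─ (here _)    (there z∈ys) _   = z∈ys
  ∈-─ (there _)   (here z≡y)   _   = here z≡y
  ∈-─ (there x∈ys) (there z∈ys) z≢x = there (∈-─ x∈ys z∈ys z≢x)

  length≡1⇒singleton : ∀ (xs : List A) → length xs ≡ 1 → ∃[ x ] xs ≡ [ x ]
  length≡1⇒singleton (x ∷ []) refl = x , refl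

  unique-⊆⇒length≤ : ∀ {xs ys : List A} → Unique xs → xs ⊆ ys → length xs ≤ length ys
  unique-⊆⇒length≤ {[]}     _               _     = z≤n
  unique-⊆⇒length≤ {x ∷ xs} {ys} (x∉xs ∷ xs!) xs⊆ys =
    subst (suc (length xs) ≤_) (sym (length-removeAt′ ys (index x∈ys)))
      (s≤s (unique-⊆⇒length≤ xs! λ z∈xs →
        ∈-─ x∈ys (xs⊆ys (there z∈xs)) (λ { refl → All-lookup x∉xs z∈xs refl })))
    where
    x∈ys : x ∈ ys
    x∈ys = xs⊆ys (here refl)

module Residues (p : ℕ) .{{_ : NonZero p}} where

  infix 4 _≈_
  _≈_ : ℕ → ℕ → Set
  x ≈ y = x % p ≡ y % p

  ≈-setoid : Setoid 0ℓ 0ℓ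
  ≈-setoid = On.setoid (setoid ℕ) (_% p)

  module ≈-Reasoning = Relation.Binary.Reasoning.Setoid ≈-setoid

  open Setoid ≈-setoid public using () renaming (refl to ≈-refl; sym to ≈-sym; trans to ≈-trans)

  %-≈ : ∀ x → x % p ≈ x
  %-≈ x = m%n%n≡m%n x p

  +-cong : ∀ {a b c d} → a ≈ b → c ≈ d → a + c ≈ b + d
  +-cong {a} {b} {c} {d} a≈b c≈d = begin
    (a + c) % p           ≡⟨ %-distribˡ-+ a c p ⟩
    (a % p + c % p) % p   ≡⟨ cong₂ (λ u v → (u + v) % p) a≈b c≈d ⟩
    (b % p + d % p) % p   ≡⟨ %-distribˡ-+ b d p ⟨
    (b + d) % p           ∎
    where open ≡-Reasoning

  *-cong : ∀ {a b c d} → a ≈ b → c ≈ d → a * c ≈ b * d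
  *-cong {a} {b} {c} {d} a≈b c≈d = begin
    (a * c) % p             ≡⟨ %-distribˡ-* a c p ⟩
    (a % p * (c % p)) % p   ≡⟨ cong₂ (λ u v → (u * v) % p) a≈b c≈d ⟩
    (b % p * (d % p)) % p   ≡⟨ %-distribˡ-* b d p ⟨
    (b * d) % p             ∎
    where open ≡-Reasoning

  residue-≈⇒≡ : ∀ {x y} → x < p → y < p → x ≈ y → x ≡ y
  residue-≈⇒≡ x<p y<p x≈y = trans (sym (m<n⇒m%n≡m x<p)) (trans x≈y (m<n⇒m%n≡m y<p))

  n*p≈0 : ∀ n → n * p ≈ 0
  n*p≈0 n = trans (m*n%n≡0 n p) (sym (m*n%n≡0 0 p))

  ^-congˡ : ∀ {x y} n → x ≈ y → x ^ n ≈ y ^ n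
  ^-congˡ zero    x≈y = refl
  ^-congˡ (suc n) x≈y = *-cong x≈y (^-congˡ n x≈y)

  ^-inverse : ∀ {x n} .{{_ : NonZero n}} → x ^ n ≈ 1 → ∀ i → x ^ i * x ^ (i * (n ∸ 1)) ≈ 1
  ^-inverse {x} {n} xⁿ≈1 i = begin
    x ^ i * x ^ (i * (n ∸ 1))   ≡⟨ ^-distribˡ-+-* x i (i * (n ∸ 1)) ⟨
    x ^ (i + i * (n ∸ 1))       ≡⟨ cong (x ^_) (i+i*[n∸1]≡n*i i n) ⟩
    x ^ (n * i)                 ≡⟨ ^-*-assoc x n i ⟨
    (x ^ n) ^ i                 ≈⟨ ^-congˡ i xⁿ≈1 ⟩
    1 ^ i                       ≡⟨ ^-zeroˡ i ⟩
    1                           ∎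
    where open ≈-Reasoning

  −1 : ℕ
  −1 = p ∸ 1

  x+−1*x≈0 : ∀ x → x + −1 * x ≈ 0
  x+−1*x≈0 x = begin
    x + −1 * x        ≡⟨ cong (_* x) (m+[n∸m]≡n (>-nonZero⁻¹ p)) ⟩
    p * x             ≡⟨ *-comm p x ⟩
    x * p             ≈⟨ n*p≈0 x ⟩
    0                 ∎
    where open ≈-Reasoning

  +-cancelʳ-≈ : ∀ {a b} c → a + c ≈ b + c → a ≈ b
  +-cancelʳ-≈ {a} {b} c a+c≈b+c = begin
    a                     ≡⟨ +-identityʳ a ⟨
    a + 0                 ≈⟨ +-cong {a} ≈-refl (≈-sym (x+−1*x≈0 c)) ⟩
    a + (c + −1 * c)      ≡⟨ +-assoc a c _ ⟨
    a + c + −1 * c        ≈⟨ +-cong a+c≈b+c (≈-refl {−1 * c}) ⟩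
    b + c + −1 * c        ≡⟨ +-assoc b c _ ⟩
    b + (c + −1 * c)      ≈⟨ +-cong {b} ≈-refl (x+−1*x≈0 c) ⟩
    b + 0                 ≡⟨ +-identityʳ b ⟩
    b                     ∎
    where open ≈-Reasoning

  *-cancelˡ-≈ : ∀ {x y a b} → x * y ≈ 1 → x * a ≈ x * b → a ≈ b
  *-cancelˡ-≈ {x} {y} {a} {b} xy≈1 xa≈xb = begin
    a               ≡⟨ *-identityˡ a ⟨
    1 * a           ≈⟨ *-cong xy≈1 (≈-refl {a}) ⟨
    x * y * a       ≡⟨ cong (_* a) (*-comm x y) ⟩
    y * x * a       ≡⟨ *-assoc y x a ⟩
    y * (x * a)     ≈⟨ *-cong (≈-refl {y}) xa≈xb ⟩
    y * (x * b)     ≡⟨ *-assoc y x b ⟨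
    y * x * b       ≡⟨ cong (_* b) (*-comm y x) ⟩
    x * y * b       ≈⟨ *-cong xy≈1 (≈-refl {b}) ⟩
    1 * b           ≡⟨ *-identityˡ b ⟩
    b               ∎
    where open ≈-Reasoning

  −1*−1≈1 : −1 * −1 ≈ 1
  −1*−1≈1 = +-cancelʳ-≈ −1 (begin
    −1 * −1 + −1      ≡⟨ +-comm (−1 * −1) −1 ⟩
    −1 + −1 * −1      ≈⟨ x+−1*x≈0 −1 ⟩
    0                 ≈⟨ x+−1*x≈0 1 ⟨
    1 + −1 * 1        ≡⟨ cong (1 +_) (*-identityʳ −1) ⟩
    1 + −1            ∎)
    where open ≈-Reasoning

  x+y≈z⇒x≈z+−1*y : ∀ {x y z} → x + y ≈ z → x ≈ z + −1 * y
  x+y≈z⇒x≈z+−1*y {x} {y} {z} x+y≈z = begin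
    x                     ≡⟨ +-identityʳ x ⟨
    x + 0                 ≈⟨ +-cong (≈-refl {x}) (x+−1*x≈0 y) ⟨
    x + (y + −1 * y)      ≡⟨ +-assoc x y (−1 * y) ⟨
    x + y + −1 * y        ≈⟨ +-cong x+y≈z (≈-refl {−1 * y}) ⟩
    z + −1 * y            ∎
    where open ≈-Reasoning

  0%p≡0 : 0 % p ≡ 0
  0%p≡0 = m*n%n≡0 0 p

  ∣∧<⇒≡0 : ∀ {y} → p ∣ y → y < p → y ≡ 0
  ∣∧<⇒≡0 {zero}  _   _   = refl
  ∣∧<⇒≡0 {suc _} p∣y y<p = contradiction p∣y (>⇒∤ y<p)

  module _ (1<p : 1 < p) where

    1%p≡1 : 1 % p ≡ 1
    1%p≡1 = m<n⇒m%n≡m 1<p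

    0≉1 : ¬ (0 ≈ 1)
    0≉1 0≈1 with () ← trans (sym (m<n⇒m%n≡m (>-nonZero⁻¹ p))) (trans 0≈1 1%p≡1)

    invertible⇒%>0 : ∀ {x y} → x * y ≈ 1 → 0 < x % p
    invertible⇒%>0 {x} {y} xy≈1 with x % p in x%p≡0
    ... | suc _ = s≤s z≤n
    ... | zero  = contradiction (begin
      0 * y   ≈⟨ *-cong (trans x%p≡0 (sym 0%p≡0)) (≈-refl {y}) ⟨
      x * y   ≈⟨ xy≈1 ⟩
      1       ∎) 0≉1
      where open ≈-Reasoning

    square≈1⇒±1 : Prime p → ∀ {x} → x < p → x * x ≈ 1 → x ≡ 1 ⊎ x ≡ −1
    square≈1⇒±1 _     {zero}  _   0≈1   = contradiction 0≈1 0≉1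
    square≈1⇒±1 p-prime {suc y} x<p xx≈1 with euclidsLemma y (2 + y) p-prime p∣y[2+y]
      where
      y[2+y]≈0 : y * (2 + y) ≈ 0
      y[2+y]≈0 = +-cancelʳ-≈ 1 (begin
        y * (2 + y) + 1     ≡⟨ x*[2+x]+1≡[1+x]*[1+x] y ⟩
        suc y * suc y       ≈⟨ xx≈1 ⟩
        1                   ∎)
        where open ≈-Reasoning
      p∣y[2+y] : p ∣ y * (2 + y)
      p∣y[2+y] = m%n≡0⇒n∣m _ p (trans y[2+y]≈0 0%p≡0)
    ... | inj₁ p∣y   = inj₁ (cong suc (∣∧<⇒≡0 p∣y (<-trans (n<1+n y) x<p)))
    ... | inj₂ p∣2+y = inj₂ (cong (_∸ 1) (≤-antisym x<p (∣⇒≤ p∣2+y)))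

module CyclicSubgroup (p : ℕ) .{{_ : NonZero p}} (1<p : 1 < p)
                      (h k : ℕ) .{{_ : NonZero k}}
                      (hᵏ≈1 : Residues._≈_ p (h ^ k) 1)
                      (hⁱ≉1 : ∀ i → 0 < i → i < k → ¬ Residues._≈_ p (h ^ i) 1) where

  open Residues p

  ⟨h⟩ : List ℕ
  ⟨h⟩ = map (λ j → (h ^ j) % p) (upTo k)

  hⁿ≈h^[n%k] : ∀ n → h ^ n ≈ h ^ (n % k)
  hⁿ≈h^[n%k] n = begin
    h ^ n                             ≡⟨ cong (h ^_) (m≡m%n+[m/n]*n n k) ⟩
    h ^ (n % k + n / k * k)           ≡⟨ ^-distribˡ-+-* h (n % k) _ ⟩
    h ^ (n % k) * h ^ (n / k * k)     ≡⟨ cong (λ e → h ^ (n % k) * h ^ e) (*-comm (n / k) k) ⟩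
    h ^ (n % k) * h ^ (k * (n / k))   ≡⟨ cong (h ^ (n % k) *_) (^-*-assoc h k (n / k)) ⟨
    h ^ (n % k) * (h ^ k) ^ (n / k)   ≈⟨ *-cong (≈-refl {h ^ (n % k)}) (^-congˡ (n / k) hᵏ≈1) ⟩
    h ^ (n % k) * 1 ^ (n / k)         ≡⟨ cong (h ^ (n % k) *_) (^-zeroˡ (n / k)) ⟩
    h ^ (n % k) * 1                   ≡⟨ *-identityʳ _ ⟩
    h ^ (n % k)                       ∎
    where open ≈-Reasoning

  hⁿ∈⟨h⟩ : ∀ n → (h ^ n) % p ∈ ⟨h⟩
  hⁿ∈⟨h⟩ n = subst (_∈ ⟨h⟩) (sym (hⁿ≈h^[n%k] n)) (∈-map⁺ (λ j → (h ^ j) % p) (∈-upTo⁺ (m%n<n n k)))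

  ∈⟨h⟩⇒power : ∀ {x} → x ∈ ⟨h⟩ → ∃[ j ] x ≡ (h ^ j) % p
  ∈⟨h⟩⇒power x∈⟨h⟩ with j , _ , x≡hʲ ← ∈-map⁻ (λ j → (h ^ j) % p) x∈⟨h⟩ = j , x≡hʲ

  ⟨h⟩-*-closed : ∀ {x y} → x ∈ ⟨h⟩ → y ∈ ⟨h⟩ → (x * y) % p ∈ ⟨h⟩
  ⟨h⟩-*-closed x∈⟨h⟩ y∈⟨h⟩
    with i , refl ← ∈⟨h⟩⇒power x∈⟨h⟩ | j , refl ← ∈⟨h⟩⇒power y∈⟨h⟩ =
    subst (_∈ ⟨h⟩) (sym product) (hⁿ∈⟨h⟩ (i + j))
    where
    open ≈-Reasoning
    product : (h ^ i) % p * ((h ^ j) % p) ≈ h ^ (i + j)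
    product = begin
      (h ^ i) % p * ((h ^ j) % p)   ≈⟨ *-cong (%-≈ (h ^ i)) (%-≈ (h ^ j)) ⟩
      h ^ i * h ^ j                 ≡⟨ ^-distribˡ-+-* h i j ⟨
      h ^ (i + j)                   ∎

  ⟨h⟩-inverse : ∀ {x} → x ∈ ⟨h⟩ → ∃[ y ] (y ∈ ⟨h⟩ × x * y ≈ 1)
  ⟨h⟩-inverse x∈⟨h⟩ with i , refl ← ∈⟨h⟩⇒power x∈⟨h⟩ =
    (h ^ (i * (k ∸ 1))) % p , hⁿ∈⟨h⟩ (i * (k ∸ 1)) ,
    ≈-trans (*-cong (%-≈ (h ^ i)) (%-≈ (h ^ (i * (k ∸ 1))))) (^-inverse hᵏ≈1 i)

  ⟨h⟩-residue : ∀ {x} → x ∈ ⟨h⟩ → 0 < x × x < p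
  ⟨h⟩-residue x∈⟨h⟩ with i , refl ← ∈⟨h⟩⇒power x∈⟨h⟩ =
    invertible⇒%>0 1<p {h ^ i} {h ^ (i * (k ∸ 1))} (^-inverse hᵏ≈1 i) , m%n<n (h ^ i) p

  1∈⟨h⟩ : 1 ∈ ⟨h⟩
  1∈⟨h⟩ = subst (_∈ ⟨h⟩) (1%p≡1 1<p) (hⁿ∈⟨h⟩ 0)

  ⟨h⟩-unique : Unique ⟨h⟩
  ⟨h⟩-unique = AllPairs.map⁺ (AllPairs.applyUpTo⁺₁ id k hⁱ≉hʲ)
    where
    hⁱ≉hʲ : ∀ {i j} → i < j → j < k → (h ^ i) % p ≢ (h ^ j) % p
    hⁱ≉hʲ {i} {j} i<j j<k hⁱ≈hʲ =
      hⁱ≉1 (j ∸ i) (m<n⇒0<n∸m i<j) (≤-<-trans (m∸n≤m j i) j<k)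
        (*-cancelˡ-≈ {h ^ i} {h ^ (i * (k ∸ 1))} (^-inverse hᵏ≈1 i) (begin
          h ^ i * h ^ (j ∸ i)   ≡⟨ ^-distribˡ-+-* h i (j ∸ i) ⟨
          h ^ (i + (j ∸ i))     ≡⟨ cong (h ^_) (m+[n∸m]≡n (<⇒≤ i<j)) ⟩
          h ^ j                 ≈⟨ hⁱ≈hʲ ⟨
          h ^ i                 ≡⟨ *-identityʳ (h ^ i) ⟨
          h ^ i * 1             ∎))
      where open ≈-Reasoning

  ⟨h⟩-length : length ⟨h⟩ ≡ k
  ⟨h⟩-length = trans (length-map (λ j → (h ^ j) % p) (upTo k)) (length-applyUpTo id k)

  ⟨h⟩-isSubgroupOfOrder : IsSubgroupOfOrder p k ⟨h⟩
  ⟨h⟩-isSubgroupOfOrder =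
    ⟨h⟩-unique , ⟨h⟩-length , (λ _ → ⟨h⟩-residue) , 1∈⟨h⟩ , (λ _ _ → ⟨h⟩-*-closed) ,
    λ x x∈⟨h⟩ → let y , y∈⟨h⟩ , xy≈1 = ⟨h⟩-inverse x∈⟨h⟩ in y , y∈⟨h⟩ , trans xy≈1 (1%p≡1 1<p)

  −1∈⟨h⟩ : Prime p → 2 ∣ k → −1 ∈ ⟨h⟩
  −1∈⟨h⟩ p-prime (divides q k≡q*2) =
    [ (λ h^q≡1 → contradiction h^q≡1 h^q≢1) , (λ h^q≡−1 → subst (_∈ ⟨h⟩) h^q≡−1 (hⁿ∈⟨h⟩ q)) ]′
      (square≈1⇒±1 1<p p-prime (m%n<n (h ^ q) p) h^q-squared)
    where
    k≡q+q : k ≡ q + q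
    k≡q+q = trans k≡q*2 (trans (*-comm q 2) (cong (q +_) (+-identityʳ q)))
    0<q : 0 < q
    0<q = n≢0⇒n>0 (λ q≡0 → ≢-nonZero⁻¹ k (trans k≡q+q (cong₂ _+_ q≡0 q≡0)))
    h^q≢1 : (h ^ q) % p ≢ 1
    h^q≢1 h^q≡1 = hⁱ≉1 q 0<q (subst (q <_) (sym k≡q+q) (m<m+n q 0<q)) (trans h^q≡1 (sym (1%p≡1 1<p)))
    h^q-squared : (h ^ q) % p * ((h ^ q) % p) ≈ 1
    h^q-squared = begin
      (h ^ q) % p * ((h ^ q) % p)   ≈⟨ *-cong (%-≈ (h ^ q)) (%-≈ (h ^ q)) ⟩
      h ^ q * h ^ q                 ≡⟨ ^-distribˡ-+-* h q q ⟨
      h ^ (q + q)                   ≡⟨ cong (h ^_) k≡q+q ⟨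
      h ^ k                         ≈⟨ hᵏ≈1 ⟩
      1                             ∎
      where open ≈-Reasoning

module CyclotomicNumber
  (p : ℕ) .{{_ : NonZero p}} (p-prime : Prime p)
  (k : ℕ) (Γ : List ℕ) (Γ-subgroup : IsSubgroupOfOrder p k Γ) (−1∈Γ : Residues.−1 p ∈ Γ)
  (G G⁻¹ : ℕ) (GG⁻¹≈1 : Residues._≈_ p (G * G⁻¹) 1) where

  open Residues p

  private
    1<p : 1 < p
    1<p = prime⇒1<p p-prime

  Γ-residue : ∀ {x} → x ∈ Γ → 0 < x × x < p
  Γ-residue {x} = let (_ , _ , residue , _) = Γ-subgroup in residue x

  Γ-*-closed : ∀ {x y} → x ∈ Γ → y ∈ Γ → (x * y) % p ∈ Γ
  Γ-*-closed {x} {y} = let (_ , _ , _ , _ , closed , _) = Γ-subgroup in closed x y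

  Γ-inverse : ∀ {x} → x ∈ Γ → ∃[ y ] (y ∈ Γ × x * y ≈ 1)
  Γ-inverse {x} x∈Γ =
    let (_ , _ , _ , _ , _ , inverse) = Γ-subgroup
        (y , y∈Γ , [xy]%p≡1) = inverse x x∈Γ
    in y , y∈Γ , trans [xy]%p≡1 (sym (1%p≡1 1<p))

  Γ-≈⇒≡ : ∀ {x y} → x ∈ Γ → y ∈ Γ → x ≈ y → x ≡ y
  Γ-≈⇒≡ x∈Γ y∈Γ = residue-≈⇒≡ (proj₂ (Γ-residue x∈Γ)) (proj₂ (Γ-residue y∈Γ))

  record Solution (a b : ℕ) : Set where
    constructor solution
    field
      a∈Γ : a ∈ Γ
      b∈Γ : b ∈ Γ
      equation : a + G * b ≈ G

  no-solution-at-1 : ∀ {a} → ¬ Solution a 1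
  no-solution-at-1 {a} (solution a∈Γ _ a+G≈G) =
    <⇒≢ (proj₁ (Γ-residue a∈Γ)) (sym (residue-≈⇒≡ (proj₂ (Γ-residue a∈Γ)) (>-nonZero⁻¹ p) a≈0))
    where
    a≈0 : a ≈ 0
    a≈0 = +-cancelʳ-≈ G (begin
      a + G       ≡⟨ cong (a +_) (*-identityʳ G) ⟨
      a + G * 1   ≈⟨ a+G≈G ⟩
      0 + G       ∎)
      where open ≈-Reasoning

  solution-determined-by-b : ∀ {a a' b} → Solution a b → Solution a' b → a ≡ a'
  solution-determined-by-b {b = b} (solution a∈Γ _ a+Gb≈G) (solution a'∈Γ _ a'+Gb≈G) =
    Γ-≈⇒≡ a∈Γ a'∈Γ (+-cancelʳ-≈ (G * b) (≈-trans a+Gb≈G (≈-sym a'+Gb≈G)))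

  solution-determined-by-a : ∀ {a b b'} → Solution a b → Solution a b' → b ≡ b'
  solution-determined-by-a {a} {b} {b'} (solution _ b∈Γ a+Gb≈G) (solution _ b'∈Γ a+Gb'≈G) =
    Γ-≈⇒≡ b∈Γ b'∈Γ (*-cancelˡ-≈ {G} {G⁻¹} GG⁻¹≈1 (+-cancelʳ-≈ a (begin
      G * b + a     ≡⟨ +-comm (G * b) a ⟩
      a + G * b     ≈⟨ a+Gb≈G ⟩
      G             ≈⟨ a+Gb'≈G ⟨
      a + G * b'    ≡⟨ +-comm a (G * b') ⟩
      G * b' + a    ∎)))
    where open ≈-Reasoning

  solution-at-inverse : ∀ {a b b'} → Solution a b → b' ∈ Γ → b * b' ≈ 1 → ∃[ a' ] Solution a' b'
  solution-at-inverse {a} {b} {b'} (solution a∈Γ _ a+Gb≈G) b'∈Γ bb'≈1 =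
    a' , solution (Γ-*-closed −1∈Γ (Γ-*-closed a∈Γ b'∈Γ)) b'∈Γ (begin
      a' + G * b'                       ≈⟨ +-cong a'≈−ab' (≈-refl {G * b'}) ⟩
      −1 * (a * b') + G * b'            ≈⟨ +-cong (≈-refl {−1 * (a * b')}) ab'+G≈Gb' ⟨
      −1 * (a * b') + (a * b' + G)      ≡⟨ +-assoc (−1 * (a * b')) (a * b') G ⟨
      −1 * (a * b') + a * b' + G        ≡⟨ cong (_+ G) (+-comm (−1 * (a * b')) (a * b')) ⟩
      a * b' + −1 * (a * b') + G        ≈⟨ +-cong (x+−1*x≈0 (a * b')) (≈-refl {G}) ⟩
      0 + G                             ∎)
    where
    open ≈-Reasoning
    a' : ℕ
    a' = (−1 * ((a * b') % p)) % p
    a'≈−ab' : a' ≈ −1 * (a * b')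
    a'≈−ab' = ≈-trans (%-≈ _) (*-cong (≈-refl { −1}) (%-≈ (a * b')))
    ab'+G≈Gb' : a * b' + G ≈ G * b'
    ab'+G≈Gb' = begin
      a * b' + G               ≡⟨ cong (a * b' +_) (*-identityʳ G) ⟨
      a * b' + G * 1           ≈⟨ +-cong (≈-refl {a * b'}) (*-cong (≈-refl {G}) bb'≈1) ⟨
      a * b' + G * (b * b')    ≡⟨ cong (a * b' +_) (*-assoc G b b') ⟨
      a * b' + G * b * b'      ≡⟨ *-distribʳ-+ b' a (G * b) ⟨
      (a + G * b) * b'         ≈⟨ *-cong a+Gb≈G (≈-refl {b'}) ⟩
      G * b'                   ∎

  solution-at-−1⇒≈G+G : ∀ {a} → Solution a −1 → a ≈ G + G
  solution-at-−1⇒≈G+G {a} (solution _ _ a+G*−1≈G) = begin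
    a                       ≡⟨ +-identityʳ a ⟨
    a + 0                   ≈⟨ +-cong (≈-refl {a}) (x+−1*x≈0 G) ⟨
    a + (G + −1 * G)        ≡⟨ cong (a +_) (+-comm G (−1 * G)) ⟩
    a + (−1 * G + G)        ≡⟨ +-assoc a (−1 * G) G ⟨
    a + −1 * G + G          ≡⟨ cong (λ x → a + x + G) (*-comm −1 G) ⟩
    a + G * −1 + G          ≈⟨ +-cong a+G*−1≈G (≈-refl {G}) ⟩
    G + G                   ∎
    where open ≈-Reasoning

  ≈G+G⇒solution-at-−1 : ∀ {a} → a ∈ Γ → a ≈ G + G → Solution a −1
  ≈G+G⇒solution-at-−1 {a} a∈Γ a≈G+G = solution a∈Γ −1∈Γ (begin
    a + G * −1              ≈⟨ +-cong a≈G+G (≈-refl {G * −1}) ⟩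
    G + G + G * −1          ≡⟨ +-assoc G G (G * −1) ⟩
    G + (G + G * −1)        ≡⟨ cong (λ x → G + (G + x)) (*-comm G −1) ⟩
    G + (G + −1 * G)        ≈⟨ +-cong (≈-refl {G}) (x+−1*x≈0 G) ⟩
    G + 0                   ≡⟨ +-identityʳ G ⟩
    G                       ∎)
    where open ≈-Reasoning

  solution-with-b²≈1⇒b≡−1 : ∀ {a b} → Solution a b → b * b ≈ 1 → b ≡ −1
  solution-with-b²≈1⇒b≡−1 {a} sol@(solution _ b∈Γ _) b²≈1 =
    [ (λ { refl → contradiction sol no-solution-at-1 }) , id ]′
      (square≈1⇒±1 1<p p-prime (proj₂ (Γ-residue b∈Γ)) b²≈1)

  solution-with-unique-b⇒b≡−1 : ∀ {a b} → Solution a b → (∀ {a' b'} → Solution a' b' → b' ≡ b) → b ≡ −1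
  solution-with-unique-b⇒b≡−1 {b = b} sol@(solution _ b∈Γ _) b-unique =
    let (b' , b'∈Γ , bb'≈1) = Γ-inverse b∈Γ
        (_ , sol') = solution-at-inverse sol b'∈Γ bb'≈1
    in solution-with-b²≈1⇒b≡−1 sol (subst (λ x → b * x ≈ 1) (b-unique sol') bb'≈1)

  module _ (2⁻¹ : ℕ) (2⁻¹<p : 2⁻¹ < p) (2*2⁻¹≈1 : 2 * 2⁻¹ ≈ 1) where

    GΓ : List ℕ
    GΓ = map (λ γ → (G * γ) % p) Γ

    2⁻¹≈G*inverse : ∀ {a γ} → a ≈ G + G → a * γ ≈ 1 → 2⁻¹ ≈ G * γ
    2⁻¹≈G*inverse {a} {γ} a≈G+G aγ≈1 = *-cancelˡ-≈ {2} {2⁻¹} 2*2⁻¹≈1 (begin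
      2 * 2⁻¹          ≈⟨ 2*2⁻¹≈1 ⟩
      1                ≈⟨ aγ≈1 ⟨
      a * γ            ≈⟨ *-cong a≈G+G (≈-refl {γ}) ⟩
      (G + G) * γ      ≡⟨ [x+x]*y≡2*[x*y] G γ ⟩
      2 * (G * γ)      ∎)
      where open ≈-Reasoning

    inverse≈G+G : ∀ {γ δ} → 2⁻¹ ≈ G * γ → γ * δ ≈ 1 → δ ≈ G + G
    inverse≈G+G {γ} {δ} 2⁻¹≈Gγ γδ≈1 = *-cancelˡ-≈ {γ} {δ} γδ≈1 (begin
      γ * δ            ≈⟨ γδ≈1 ⟩
      1                ≈⟨ 2*2⁻¹≈1 ⟨
      2 * 2⁻¹          ≈⟨ *-cong (≈-refl {2}) 2⁻¹≈Gγ ⟩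
      2 * (G * γ)      ≡⟨ [x+x]*y≡2*[x*y] G γ ⟨
      (G + G) * γ      ≡⟨ *-comm (G + G) γ ⟩
      γ * (G + G)      ∎)
      where open ≈-Reasoning

    solution-at-−1⇔2⁻¹∈GΓ : (∃[ a ] Solution a −1) ⇔ 2⁻¹ ∈ GΓ
    solution-at-−1⇔2⁻¹∈GΓ = mk⇔ to from
      where
      to : ∃[ a ] Solution a −1 → 2⁻¹ ∈ GΓ
      to (a , sol@(solution a∈Γ _ _)) =
        let (γ , γ∈Γ , aγ≈1) = Γ-inverse a∈Γ
            2⁻¹≈Gγ = 2⁻¹≈G*inverse (solution-at-−1⇒≈G+G sol) aγ≈1
        in subst (_∈ GΓ)
             (residue-≈⇒≡ (m%n<n (G * γ) p) 2⁻¹<p (≈-trans (%-≈ (G * γ)) (≈-sym 2⁻¹≈Gγ)))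
             (∈-map⁺ (λ γ → (G * γ) % p) γ∈Γ)
      from : 2⁻¹ ∈ GΓ → ∃[ a ] Solution a −1
      from 2⁻¹∈GΓ =
        let (γ , γ∈Γ , 2⁻¹≡Gγ) = ∈-map⁻ (λ γ → (G * γ) % p) 2⁻¹∈GΓ
            (δ , δ∈Γ , γδ≈1) = Γ-inverse γ∈Γ
            2⁻¹≈Gγ = ≈-trans (cong (_% p) 2⁻¹≡Gγ) (%-≈ (G * γ))
        in δ , ≈G+G⇒solution-at-−1 δ∈Γ (inverse≈G+G 2⁻¹≈Gγ γδ≈1)

  isSolutionᵇ : ℕ × ℕ → Bool
  isSolutionᵇ (a , b) = ⌊ a ∈? Γ ⌋ ∧ ⌊ b ∈? Γ ⌋ ∧ ((a + G * b) % p ≡ᵇ G % p)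

  solutions : List (ℕ × ℕ)
  solutions = filterᵇ isSolutionᵇ (cartesianProduct (upTo p) (upTo p))

  solutions-unique : Unique solutions
  solutions-unique =
    Unique.filter⁺ (T? ∘ isSolutionᵇ) (Unique.cartesianProduct⁺ (Unique.upTo⁺ p) (Unique.upTo⁺ p))

  T-isSolutionᵇ : ∀ {a b} → T (isSolutionᵇ (a , b)) ⇔ Solution a b
  T-isSolutionᵇ {a} {b} = mk⇔ to from
    where
    to : T (isSolutionᵇ (a , b)) → Solution a b
    to t =
      let (a∈?Γ , t′) = Equivalence.to (T-∧ {⌊ a ∈? Γ ⌋}) t
          (b∈?Γ , a+Gb≡ᵇG) = Equivalence.to (T-∧ {⌊ b ∈? Γ ⌋}) t′
      in solution (toWitness a∈?Γ) (toWitness b∈?Γ) (≡ᵇ⇒≡ _ _ a+Gb≡ᵇG)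
    from : Solution a b → T (isSolutionᵇ (a , b))
    from (solution a∈Γ b∈Γ a+Gb≈G) =
      Equivalence.from (T-∧ {⌊ a ∈? Γ ⌋})
        (fromWitness a∈Γ , Equivalence.from (T-∧ {⌊ b ∈? Γ ⌋}) (fromWitness b∈Γ , ≡⇒≡ᵇ _ _ a+Gb≈G))

  ∈-solutions⇔ : ∀ {a b} → (a , b) ∈ solutions ⇔ Solution a b
  ∈-solutions⇔ = mk⇔
    (λ ab∈solutions → Equivalence.to T-isSolutionᵇ
      (proj₂ (∈-filter⁻ (T? ∘ isSolutionᵇ) {xs = cartesianProduct (upTo p) (upTo p)} ab∈solutions)))
    (λ sol@(solution a∈Γ b∈Γ _) → ∈-filter⁺ (T? ∘ isSolutionᵇ)
      (∈-cartesianProduct⁺ (∈-upTo⁺ (proj₂ (Γ-residue a∈Γ))) (∈-upTo⁺ (proj₂ (Γ-residue b∈Γ))))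
      (Equivalence.from T-isSolutionᵇ sol))

  module _ (circular : Circular p k) where

    −G : ℕ
    −G = (−1 * G) % p

    intersection : List ℕ
    intersection =
      filterᵇ (λ x → ⌊ x ∈? cosetShift p Γ 1 0 ⌋ ∧ ⌊ x ∈? cosetShift p Γ −G (G % p) ⌋) (upTo p)

    intersection-length≤2 : length intersection ≤ 2
    intersection-length≤2 =
      proj₂ circular Γ Γ-subgroup 1 0 −G (G % p) (s≤s z≤n) 1<p (>-nonZero⁻¹ p)
        (invertible⇒%>0 1<p {−1 * G} {−1 * G⁻¹} −G−G⁻¹≈1) (m%n<n _ p) (m%n<n G p)
        (inj₂ (<⇒≢ (invertible⇒%>0 1<p {G} {G⁻¹} GG⁻¹≈1)))
      where
      open ≈-Reasoning
      −G−G⁻¹≈1 : −1 * G * (−1 * G⁻¹) ≈ 1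
      −G−G⁻¹≈1 = begin
        −1 * G * (−1 * G⁻¹)     ≡⟨ [m*n]*[o*p]≡[m*o]*[n*p] −1 G −1 G⁻¹ ⟩
        −1 * −1 * (G * G⁻¹)     ≈⟨ *-cong −1*−1≈1 GG⁻¹≈1 ⟩
        1                       ∎

    solution⇒∈intersection : ∀ {a b} → Solution a b → a ∈ intersection
    solution⇒∈intersection {a} {b} (solution a∈Γ b∈Γ a+Gb≈G) =
      ∈-filter⁺ (T? ∘ _) (∈-upTo⁺ a<p)
        (Equivalence.from (T-∧ {⌊ a ∈? cosetShift p Γ 1 0 ⌋}) (fromWitness a∈Γ+0 , fromWitness a∈−GΓ+G))
      where
      open ≈-Reasoning
      a<p : a < p
      a<p = proj₂ (Γ-residue a∈Γ)
      a∈Γ+0 : a ∈ cosetShift p Γ 1 0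
      a∈Γ+0 = subst (_∈ cosetShift p Γ 1 0)
        (trans (cong (_% p) (trans (+-identityʳ _) (*-identityʳ a))) (m<n⇒m%n≡m a<p))
        (∈-map⁺ (λ φ → (φ * 1 + 0) % p) a∈Γ)
      a≈b[−G]+G : a ≈ b * −G + G % p
      a≈b[−G]+G = begin
        a                       ≈⟨ x+y≈z⇒x≈z+−1*y a+Gb≈G ⟩
        G + −1 * (G * b)        ≡⟨ cong (G +_) (*-assoc −1 G b) ⟨
        G + −1 * G * b          ≡⟨ +-comm G _ ⟩
        −1 * G * b + G          ≡⟨ cong (_+ G) (*-comm (−1 * G) b) ⟩
        b * (−1 * G) + G        ≈⟨ +-cong (*-cong (≈-refl {b}) (%-≈ (−1 * G))) (%-≈ G) ⟨
        b * −G + G % p          ∎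
      a∈−GΓ+G : a ∈ cosetShift p Γ −G (G % p)
      a∈−GΓ+G = subst (_∈ cosetShift p Γ −G (G % p))
        (residue-≈⇒≡ (m%n<n _ p) a<p (≈-trans (%-≈ _) (≈-sym a≈b[−G]+G)))
        (∈-map⁺ (λ φ → (φ * −G + G % p) % p) b∈Γ)

    no-three-solutions-with-distinct-b :
      ∀ {a₁ a₂ a₃ b₁ b₂ b₃} → Solution a₁ b₁ → Solution a₂ b₂ → Solution a₃ b₃ →
      b₁ ≢ b₂ → b₁ ≢ b₃ → b₂ ≢ b₃ → ⊥
    no-three-solutions-with-distinct-b {a₁} {a₂} {a₃} sol₁ sol₂ sol₃ b₁≢b₂ b₁≢b₃ b₂≢b₃ =
      <⇒≱ (s≤s (s≤s (s≤s z≤n)))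
        (≤-trans (unique-⊆⇒length≤ a-unique a⊆intersection) intersection-length≤2)
      where
      a-distinct : ∀ {a a' b b'} → Solution a b → Solution a' b' → b ≢ b' → a ≢ a'
      a-distinct sol sol' b≢b' refl = b≢b' (solution-determined-by-a sol sol')
      a-unique : Unique (a₁ ∷ a₂ ∷ a₃ ∷ [])
      a-unique = (a-distinct sol₁ sol₂ b₁≢b₂ ∷ a-distinct sol₁ sol₃ b₁≢b₃ ∷ [])
               ∷ (a-distinct sol₂ sol₃ b₂≢b₃ ∷ []) ∷ [] ∷ []
      a⊆intersection : (a₁ ∷ a₂ ∷ a₃ ∷ []) ⊆ intersection
      a⊆intersection (here refl)                 = solution⇒∈intersection sol₁
      a⊆intersection (there (here refl))         = solution⇒∈intersection sol₂
      a⊆intersection (there (there (here refl))) = solution⇒∈intersection sol₃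

    solution-at-−1⇒b≡−1 : ∀ {δ a b} → Solution δ −1 → Solution a b → b ≡ −1
    solution-at-−1⇒b≡−1 {b = b} solδ sol@(solution _ b∈Γ _) =
      decidable-stable (b ≟ −1) λ b≢−1 →
        let (b' , b'∈Γ , bb'≈1) = Γ-inverse b∈Γ
            (_ , sol') = solution-at-inverse sol b'∈Γ bb'≈1
        in no-three-solutions-with-distinct-b sol sol' solδ (b≢b' b≢−1 bb'≈1) b≢−1 (b'≢−1 b≢−1 bb'≈1)
      where
      b≢b' : ∀ {b'} → b ≢ −1 → b * b' ≈ 1 → b ≢ b'
      b≢b' b≢−1 bb'≈1 b≡b' =
        b≢−1 (solution-with-b²≈1⇒b≡−1 sol (subst (λ x → b * x ≈ 1) (sym b≡b') bb'≈1))
      b'≢−1 : ∀ {b'} → b ≢ −1 → b * b' ≈ 1 → b' ≢ −1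
      b'≢−1 {b'} b≢−1 bb'≈1 b'≡−1 =
        b≢−1 (Γ-≈⇒≡ b∈Γ −1∈Γ (*-cancelˡ-≈ {−1} {−1} −1*−1≈1 (begin
          −1 * b     ≡⟨ *-comm −1 b ⟩
          b * −1     ≡⟨ cong (b *_) b'≡−1 ⟨
          b * b'     ≈⟨ bb'≈1 ⟩
          1          ≈⟨ −1*−1≈1 ⟨
          −1 * −1    ∎)))
        where open ≈-Reasoning

    length-solutions≡1⇔solution-at-−1 : length solutions ≡ 1 ⇔ (∃[ a ] Solution a −1)
    length-solutions≡1⇔solution-at-−1 = mk⇔ to from
      where
      only-solution : ∀ {a b} → solutions ≡ [ (a , b) ] → Solution a −1
      only-solution {a} {b} solutions≡[ab] = subst (Solution a) (solution-with-unique-b⇒b≡−1 sol b-unique) sol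
        where
        sol : Solution a b
        sol = Equivalence.to ∈-solutions⇔ (subst ((a , b) ∈_) (sym solutions≡[ab]) (here refl))
        b-unique : ∀ {a' b'} → Solution a' b' → b' ≡ b
        b-unique sol' with here refl ← subst (_ ∈_) solutions≡[ab] (Equivalence.from ∈-solutions⇔ sol') = refl
      to : length solutions ≡ 1 → ∃[ a ] Solution a −1
      to length≡1 with (a , _) , solutions≡[ab] ← length≡1⇒singleton solutions length≡1 =
        a , only-solution solutions≡[ab]
      from : ∃[ a ] Solution a −1 → length solutions ≡ 1
      from (δ , solδ) = ≤-antisym
        (unique-⊆⇒length≤ {ys = [ (δ , −1) ]} solutions-unique λ z∈ → here (≡δ−1 z∈))
        (unique-⊆⇒length≤ {xs = [ (δ , −1) ]} ([] ∷ [])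
          λ { (here refl) → Equivalence.from ∈-solutions⇔ solδ })
        where
        ≡δ−1 : ∀ {z} → z ∈ solutions → z ≡ (δ , −1)
        ≡δ−1 {a , b} z∈ =
          let sol = Equivalence.to ∈-solutions⇔ z∈
              b≡−1 = solution-at-−1⇒b≡−1 solδ sol
          in cong₂ _,_ (solution-determined-by-b (subst (Solution a) b≡−1 sol) solδ) b≡−1

module PrimitiveRootPower {p g : ℕ} .{{_ : NonZero p}} (1<p : 1 < p) (g-primitive : PrimitiveRoot p g)
                          {d k : ℕ} (0<d : 0 < d) (d*k≡p∸1 : d * k ≡ p ∸ 1) where

  open Residues p

  instance
    d-nonZero : NonZero d
    d-nonZero = >-nonZero 0<d

    k-nonZero : NonZero k
    k-nonZero = ≢-nonZero λ k≡0 →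
      <⇒≢ (m<n⇒0<n∸m 1<p) (trans (sym (*-zeroʳ d)) (trans (cong (d *_) (sym k≡0)) d*k≡p∸1))

  gᵖ⁻¹≈1 : g ^ (p ∸ 1) ≈ 1
  gᵖ⁻¹≈1 = trans (proj₁ g-primitive) (sym (1%p≡1 1<p))

  gᵈᵏ≈1 : (g ^ d) ^ k ≈ 1
  gᵈᵏ≈1 = begin
    (g ^ d) ^ k     ≡⟨ ^-*-assoc g d k ⟩
    g ^ (d * k)     ≡⟨ cong (g ^_) d*k≡p∸1 ⟩
    g ^ (p ∸ 1)     ≈⟨ gᵖ⁻¹≈1 ⟩
    1               ∎
    where open ≈-Reasoning

  gᵈⁱ≉1 : ∀ i → 0 < i → i < k → ¬ (g ^ d) ^ i ≈ 1
  gᵈⁱ≉1 i 0<i i<k gᵈⁱ≈1 =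
    proj₂ g-primitive (d * i) (>-nonZero⁻¹ (d * i) {{m*n≢0 d i {{d-nonZero}} {{>-nonZero 0<i}}}})
      (subst (d * i <_) d*k≡p∸1 (*-monoʳ-< d i<k))
      (trans (cong (_% p) (sym (^-*-assoc g d i))) (trans gᵈⁱ≈1 (1%p≡1 1<p)))

lemma5p5 : (p g d k m : ℕ) → .{{_ : NonZero p}} →
    Prime p → p ≢ 2 → PrimitiveRoot p g →
    0 < d → d * k ≡ p ∸ 1 →
    Circular p k → 2 ∣ k → m < d →
    (inv2 : ℕ) → inv2 < p → (2 * inv2) % p ≡ 1 →
    (c0mm p g d k m ≡ 1 ⇔ inv2 ∈ Xlist p g d k m)
-- The goal is accepted because
-- c0mm and Xlist unfold to length solutions and GΓ for Γ = ⟨g^d⟩ and G = g^m.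
lemma5p5 p g d k m p-prime _ g-primitive 0<d d*k≡p∸1 circular 2∣k _ 2⁻¹ 2⁻¹<p 2*2⁻¹≡1 =
  ⇔-trans (length-solutions≡1⇔solution-at-−1 circular)
          (solution-at-−1⇔2⁻¹∈GΓ 2⁻¹ 2⁻¹<p (trans 2*2⁻¹≡1 (sym (1%p≡1 1<p))))
  where
  open Residues p
  1<p : 1 < p
  1<p = prime⇒1<p p-prime
  instance
    p∸1-nonZero : NonZero (p ∸ 1)
    p∸1-nonZero = >-nonZero (m<n⇒0<n∸m 1<p)
  open PrimitiveRootPower 1<p g-primitive 0<d d*k≡p∸1
  open CyclicSubgroup p 1<p (g ^ d) k gᵈᵏ≈1 gᵈⁱ≉1
  open CyclotomicNumber p p-prime k ⟨h⟩ ⟨h⟩-isSubgroupOfOrder (−1∈⟨h⟩ p-prime 2∣k)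
                        (g ^ m) _ (^-inverse {g} {p ∸ 1} gᵖ⁻¹≈1 m)
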